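{- Let $S=\langle a,b\rangle$ where $a,b$ are integers with $2\le a<b$ and $\gcd(a,b)=1$, and let $r(S)$ be its ordinarization number. (1) If $a$ is odd, then $0 \le r(S) - \left(\frac{ab-a-4}{8} - \frac{b+3}{8a}\right) \le \frac{a}{4}-\frac{1}{4a}$. (2) If $a$ is even, then $0 \le r(S) - \frac{ab-a-4}{8} \le \frac{a}{4}$.
   Context: $\langle a,b\rangle=\{xa+yb: x,y\in\mathbb{N}_0\}$. For a numerical semigroup $S$ (additive submonoid of $\mathbb{N}_0$ with finite complement) of genus $g$ (number of elements of $\mathbb{N}_0\setminus S$), let $F(S)$ be the largest gap and $m(S)$ the smallest nonzero element; with $S_g=\{0,g+1,g+2,\ldots\}$, the ordinarization number $r(S)$ is the number of iterations of $T\mapsto T\cup\{F(T)\}\setminus\{m(T)\}$ needed to go from $S$ to $S_g$. It is known that $r(S)=\#(S\cap\{1,\ldots,g\})$. -}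

module Defs where

open import Data.Nat using (ℕ; zero; suc; _+_; _*_; _≤_; _<_)
open import Data.Integer using (ℤ)
open import Data.Rational using (ℚ; 0ℚ; _/_)
open import Data.Product using (Σ; ∃; ∃-syntax; _×_; _,_)
open import Data.Sum using (_⊎_)
open import Data.List using (List; length)
open import Data.List.Membership.Propositional using (_∈_)
open import Data.List.Relation.Unary.Unique.Propositional using (Unique)
open import Relation.Binary.PropositionalEquality using (_≡_; _≢_)
open import Relation.Nullary using (¬_)
open import Level using (Lift)

SubsetN : Set₁
SubsetN = ℕ → Set

_≐_ : SubsetN → SubsetN → Set
T ≐ U = ∀ n → (T n → U n) × (U n → T n)

⟨_,_⟩ : ℕ → ℕ → SubsetN
⟨ a , b ⟩ n = ∃[ x ] ∃[ y ] (n ≡ x * a + y * b)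

HasGenus : SubsetN → ℕ → Set
HasGenus T g = ∃[ xs ] (Unique xs × (∀ n → (n ∈ xs → ¬ T n) × (¬ T n → n ∈ xs)) × length xs ≡ g)

Ordinary : ℕ → SubsetN
Ordinary g n = (n ≡ 0) ⊎ (g < n)

IsFrobenius : SubsetN → ℕ → Set
IsFrobenius T f = ¬ T f × (∀ n → ¬ T n → n ≤ f)

IsMultiplicity : SubsetN → ℕ → Set
IsMultiplicity T m = 0 < m × T m × (∀ n → 0 < n → T n → m ≤ n)

Step : SubsetN → SubsetN → Set
Step T U = ∃[ f ] ∃[ m ] (IsFrobenius T f × IsMultiplicity T m ×
             (U ≐ (λ n → (T n ⊎ n ≡ f) × n ≢ m)))

Iter : ℕ → SubsetN → SubsetN → Set₁
Iter zero T U = Lift _ (U ≐ T)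
Iter (suc k) T U = Σ SubsetN λ V → Step T V × Iter k V U

IsOrdinarizationNumber : SubsetN → ℕ → Set₁
IsOrdinarizationNumber S r =
  ∃[ g ] (HasGenus S g × Iter r S (Ordinary g) × (∀ k → k < r → ¬ Iter k S (Ordinary g)))

-- Rational n/d (d is always nonzero where used; totalised at d = 0).
_/ₙ_ : ℤ → ℕ → ℚ
n /ₙ zero = 0ℚ
n /ₙ suc d = n / suc d

{-# OPTIONS --safe #-}
module Submission where

-- For a set P ∋ 0 with g gaps, ordinarization takes exactly #(P ∩ [1, g]) steps: as long as
-- P ∩ [1, g] is nonempty, a step removes its least element and fills the largest gap, which lies
-- above g, and no step can remove more than one element of [1, g].
--
-- For S = ⟨a, b⟩ every n has at most one representation x a + y b with y < a, and n ↦ c - 1 - n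
-- exchanges elements and gaps below the conductor c = (a - 1)(b - 1), so g = c / 2. Counting the
-- representations up to g gives, with K = ⌊a / 2⌋ and the residues ρ y = (g - y b) mod a,
--   a (r + 1) + Σ_{y<K} ρ y + b Σ_{y<K} y = K (g + a).
-- The ρ y for y < K are distinct residues modulo a, so their sum lies between K (K - 1) / 2 and
-- K (2a - K - 1) / 2; these two extremes give the two bounds.

open import Defs
open import Data.Nat using (ℕ; _≤_; _<_; _*_)
open import Data.Nat.GCD using (gcd)
open import Data.Nat.Divisibility using (_∣_)
open import Data.Rational using (ℚ; 0ℚ) renaming (_≤_ to _≤ℚ_; _-_ to _-ℚ_)
open import Data.Product using (∃-syntax; _×_)
open import Relation.Binary.PropositionalEquality using (_≡_)
open import Relation.Nullary using (¬_)

open import Data.Empty using (⊥)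
open import Data.List using (List; []; _∷_; length; applyUpTo; filter)
open import Data.List.Membership.Propositional using (_∈_)
open import Data.List.Membership.Propositional.Properties using (∈-applyUpTo⁻; ∈-filter⁻)
open import Data.List.Properties using (length-applyUpTo; filter-accept; filter-reject; filter-all)
open import Data.List.Relation.Unary.Any using (here; there)
open import Data.List.Relation.Unary.Unique.Propositional using (Unique)
open import Data.Nat using (zero; suc; pred; _+_; _∸_; _≟_; _≤?_; _<?_; z≤n; s≤s; _/_; _%_; compare; less; equal; greater)
open import Data.Nat.Coprimality using (Coprime; coprime-divisor; coprime-Bézout; gcd≡1⇒coprime)
open import Data.Nat.DivMod using (m≡m%n+[m/n]*n; m%n<n)
open import Data.Nat.Divisibility using (_∣?_; _∣0; divides; ∣m+n∣m⇒∣n; n∣m*n; >⇒∤; ∣⇒≤; ∣1⇒≡1)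
open import Data.Nat.GCD using (module Bézout)
open import Data.Nat.ListAction using (sum)
open import Data.Nat.Properties
open import Algebra.Properties.CommutativeSemigroup +-commutativeSemigroup using (interchange; x∙yz≈y∙xz)
open import Data.Nat.Tactic.RingSolver using (solve-∀)
open import Data.Product using (Σ; _,_; proj₁; proj₂; uncurry)
open import Data.Sum using (_⊎_; inj₁; inj₂; [_,_]′)
open import Function using (_∘_; _⇔_; mk⇔; Equivalence)
open import Level using (lift)
open import Relation.Binary.PropositionalEquality
  using (refl; sym; trans; cong; cong₂; subst; subst₂; _≢_; ≢-sym; module ≡-Reasoning)
open import Relation.Nullary using (Dec; yes; no; contradiction)
open import Relation.Nullary.Decidable using (¬?; _×-dec_; _⊎-dec_; map′; decidable-stable)
open import Relation.Unary using (Decidable)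

import Data.Nat.Coprimality as Coprime
import Data.List.Membership.DecPropositional _≟_ as DecMembership
import Data.List.Relation.Unary.AllPairs as AllPairs
import Data.List.Relation.Unary.All as All
import Data.List.Relation.Unary.Unique.Propositional.Properties as Unique

-- Sums, counts and member lists over ranges

∑ : (ℕ → ℕ) → ℕ → ℕ → ℕ
∑ f lo zero    = 0
∑ f lo (suc k) = f lo + ∑ f (suc lo) k

InRange : ℕ → ℕ → ℕ → Set
InRange lo k i = lo ≤ i × i < lo + k

lo∈range : ∀ lo k → InRange lo (suc k) lo
lo∈range lo k = ≤-refl , m<m+n lo (s≤s z≤n)

range-suc : ∀ {lo k i} → InRange (suc lo) k i → InRange lo (suc k) i
range-suc {lo} {k} {i} (lo<i , i<) = <⇒≤ lo<i , subst (i <_) (sym (+-suc lo k)) i<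

range-pred : ∀ {lo k i} → InRange lo (suc k) i → i ≢ lo → InRange (suc lo) k i
range-pred {lo} {k} {i} (lo≤i , i<) i≢lo = ≤∧≢⇒< lo≤i (i≢lo ∘ sym) , subst (i <_) (+-suc lo k) i<

range-empty : ∀ {lo i} → ¬ InRange lo 0 i
range-empty {lo} (lo≤i , i<lo+0) = <⇒≱ i<lo+0 (subst (_≤ _) (sym (+-identityʳ lo)) lo≤i)

∑-cong : ∀ {f g : ℕ → ℕ} {lo} k → (∀ {i} → InRange lo k i → f i ≡ g i) → ∑ f lo k ≡ ∑ g lo k
∑-cong zero    f≡g = refl
∑-cong {lo = lo} (suc k) f≡g = cong₂ _+_ (f≡g (lo∈range lo k)) (∑-cong k (f≡g ∘ range-suc))

∑-split : ∀ f lo m n → ∑ f lo (m + n) ≡ ∑ f lo m + ∑ f (lo + m) n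
∑-split f lo zero    n = cong (λ x → ∑ f x n) (sym (+-identityʳ lo))
∑-split f lo (suc m) n = begin
  f lo + ∑ f (suc lo) (m + n)                   ≡⟨ cong (f lo +_) (∑-split f (suc lo) m n) ⟩
  f lo + (∑ f (suc lo) m + ∑ f (suc lo + m) n)  ≡⟨ sym (+-assoc (f lo) _ _) ⟩
  f lo + ∑ f (suc lo) m + ∑ f (suc lo + m) n    ≡⟨ cong (λ x → f lo + ∑ f (suc lo) m + ∑ f x n) (sym (+-suc lo m)) ⟩
  f lo + ∑ f (suc lo) m + ∑ f (lo + suc m) n    ∎
  where open ≡-Reasoning

∑-snoc : ∀ f lo k → ∑ f lo (suc k) ≡ ∑ f lo k + f (lo + k)
∑-snoc f lo k = begin
  ∑ f lo (suc k)                 ≡⟨ cong (∑ f lo) (+-comm 1 k) ⟩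
  ∑ f lo (k + 1)                 ≡⟨ ∑-split f lo k 1 ⟩
  ∑ f lo k + (f (lo + k) + 0)    ≡⟨ cong (∑ f lo k +_) (+-identityʳ _) ⟩
  ∑ f lo k + f (lo + k)          ∎
  where open ≡-Reasoning

∑-shift : ∀ f m lo k → ∑ f (m + lo) k ≡ ∑ (f ∘ (m +_)) lo k
∑-shift f m lo zero    = refl
∑-shift f m lo (suc k) = cong (f (m + lo) +_) (trans (cong (λ x → ∑ f x k) (sym (+-suc m lo))) (∑-shift f m (suc lo) k))

∑-distrib-+ : ∀ f g lo k → ∑ (λ i → f i + g i) lo k ≡ ∑ f lo k + ∑ g lo k
∑-distrib-+ f g lo zero    = refl
∑-distrib-+ f g lo (suc k) =
  trans (cong (f lo + g lo +_) (∑-distrib-+ f g (suc lo) k)) (interchange (f lo) (g lo) _ _)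

*-distribˡ-∑ : ∀ c f lo k → c * ∑ f lo k ≡ ∑ (λ i → c * f i) lo k
*-distribˡ-∑ c f lo zero    = *-zeroʳ c
*-distribˡ-∑ c f lo (suc k) = trans (*-distribˡ-+ c (f lo) _) (cong (c * f lo +_) (*-distribˡ-∑ c f (suc lo) k))

∑-const : ∀ c lo k → ∑ (λ _ → c) lo k ≡ k * c
∑-const c lo zero    = refl
∑-const c lo (suc k) = cong (c +_) (∑-const c (suc lo) k)

∑-zero : ∀ lo k → ∑ (λ _ → 0) lo k ≡ 0
∑-zero lo k = trans (∑-const 0 lo k) (*-zeroʳ k)

∑-comm : ∀ (F : ℕ → ℕ → ℕ) lo k lo′ k′ →
         ∑ (λ i → ∑ (F i) lo′ k′) lo k ≡ ∑ (λ j → ∑ (λ i → F i j) lo k) lo′ k′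
∑-comm F lo zero    lo′ k′ = sym (∑-zero lo′ k′)
∑-comm F lo (suc k) lo′ k′ = begin
  ∑ (F lo) lo′ k′ + ∑ (λ i → ∑ (F i) lo′ k′) (suc lo) k
    ≡⟨ cong (∑ (F lo) lo′ k′ +_) (∑-comm F (suc lo) k lo′ k′) ⟩
  ∑ (F lo) lo′ k′ + ∑ (λ j → ∑ (λ i → F i j) (suc lo) k) lo′ k′
    ≡⟨ sym (∑-distrib-+ (F lo) _ lo′ k′) ⟩
  ∑ (λ j → ∑ (λ i → F i j) lo (suc k)) lo′ k′
    ∎
  where open ≡-Reasoning

∑-reverse : ∀ f k → ∑ (λ i → f (k ∸ suc i)) 0 k ≡ ∑ f 0 k
∑-reverse f zero    = refl
∑-reverse f (suc k) = begin
  f k + ∑ (λ i → f (suc k ∸ suc i)) 1 k   ≡⟨ cong (f k +_) (∑-shift (λ i → f (suc k ∸ suc i)) 1 0 k) ⟩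
  f k + ∑ (λ i → f (k ∸ suc i)) 0 k       ≡⟨ cong (f k +_) (∑-reverse f k) ⟩
  f k + ∑ f 0 k                           ≡⟨ +-comm (f k) _ ⟩
  ∑ f 0 k + f k                           ≡⟨ sym (∑-snoc f 0 k) ⟩
  ∑ f 0 (suc k)                           ∎
  where open ≡-Reasoning

gauss-sum : ∀ k → 2 * ∑ (λ i → i) 0 k + k ≡ k * k
gauss-sum zero    = refl
gauss-sum (suc k) = begin
  2 * ∑ (λ i → i) 0 (suc k) + suc k    ≡⟨ cong (λ s → 2 * s + suc k) (∑-snoc (λ i → i) 0 k) ⟩
  2 * (∑ (λ i → i) 0 k + k) + suc k    ≡⟨ regroup (∑ (λ i → i) 0 k) k ⟩
  (2 * ∑ (λ i → i) 0 k + k) + 2 * k + 1 ≡⟨ cong (λ s → s + 2 * k + 1) (gauss-sum k) ⟩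
  k * k + 2 * k + 1                     ≡⟨ square-suc k ⟩
  suc k * suc k                         ∎
  where
  open ≡-Reasoning
  regroup : ∀ s k → 2 * (s + k) + suc k ≡ (2 * s + k) + 2 * k + 1
  regroup = solve-∀
  square-suc : ∀ k → k * k + 2 * k + 1 ≡ suc k * suc k
  square-suc = solve-∀

𝟙 : {A : Set} → Dec A → ℕ
𝟙 (yes _) = 1
𝟙 (no _)  = 0

𝟙-yes : ∀ {A : Set} (a? : Dec A) → A → 𝟙 a? ≡ 1
𝟙-yes (yes _) _ = refl
𝟙-yes (no ¬a) a = contradiction a ¬a

𝟙-no : ∀ {A : Set} (a? : Dec A) → ¬ A → 𝟙 a? ≡ 0
𝟙-no (yes a) ¬a = contradiction a ¬a
𝟙-no (no _)  _  = refl

𝟙-cong : ∀ {A B : Set} (a? : Dec A) (b? : Dec B) → A ⇔ B → 𝟙 a? ≡ 𝟙 b?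
𝟙-cong (yes _) (yes _) _   = refl
𝟙-cong (no _)  (no _)  _   = refl
𝟙-cong (yes a) (no ¬b) A⇔B = contradiction (Equivalence.to A⇔B a) ¬b
𝟙-cong (no ¬a) (yes b) A⇔B = contradiction (Equivalence.from A⇔B b) ¬a

count : {P : ℕ → Set} → Decidable P → ℕ → ℕ → ℕ
count P? = ∑ (𝟙 ∘ P?)

module _ {P : ℕ → Set} (P? : Decidable P) where

  count-complement : ∀ lo k → count P? lo k + count (¬? ∘ P?) lo k ≡ k
  count-complement lo k = begin
    count P? lo k + count (¬? ∘ P?) lo k   ≡⟨ sym (∑-distrib-+ (𝟙 ∘ P?) (𝟙 ∘ ¬? ∘ P?) lo k) ⟩
    ∑ (λ i → 𝟙 (P? i) + 𝟙 (¬? (P? i))) lo k ≡⟨ ∑-cong k (λ {i} _ → 𝟙+𝟙¬ (P? i)) ⟩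
    ∑ (λ _ → 1) lo k                        ≡⟨ trans (∑-const 1 lo k) (*-identityʳ k) ⟩
    k                                       ∎
    where
    open ≡-Reasoning
    𝟙+𝟙¬ : ∀ {A : Set} (a? : Dec A) → 𝟙 a? + 𝟙 (¬? a?) ≡ 1
    𝟙+𝟙¬ (yes _) = refl
    𝟙+𝟙¬ (no _)  = refl

  count-none : ∀ {lo} k → (∀ {i} → InRange lo k i → ¬ P i) → count P? lo k ≡ 0
  count-none {lo} k none = trans (∑-cong k (λ {i} i∈ → 𝟙-no (P? i) (none i∈))) (∑-zero lo k)

  count≡0⇒¬ : ∀ {lo} k → count P? lo k ≡ 0 → ∀ {i} → InRange lo k i → ¬ P i
  count≡0⇒¬ zero    _ i∈ = contradiction i∈ range-empty
  count≡0⇒¬ {lo} (suc k) c≡0 {i} i∈ Pi with P? lo | i ≟ lo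
  ... | no ¬Plo | yes refl = ¬Plo Pi
  ... | no _    | no i≢lo  = count≡0⇒¬ k c≡0 (range-pred i∈ i≢lo) Pi
  ... | yes _   | _        = contradiction c≡0 λ ()

  count>0⇒∃ : ∀ {lo} k → 0 < count P? lo k → ∃[ i ] (InRange lo k i × P i)
  count>0⇒∃ {lo} (suc k) c>0 with P? lo
  ... | yes Plo = lo , lo∈range lo k , Plo
  ... | no _    with count>0⇒∃ k c>0
  ...   | i , i∈ , Pi = i , range-suc i∈ , Pi

module _ {P Q : ℕ → Set} (P? : Decidable P) (Q? : Decidable Q) where

  count-cong : ∀ {lo} k → (∀ {i} → InRange lo k i → P i ⇔ Q i) → count P? lo k ≡ count Q? lo k
  count-cong k P⇔Q = ∑-cong k (λ {i} i∈ → 𝟙-cong (P? i) (Q? i) (P⇔Q i∈))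

  count-remove : ∀ {lo} k {p} → InRange lo k p → P p → ¬ Q p →
                 (∀ {i} → InRange lo k i → i ≢ p → P i ⇔ Q i) →
                 count P? lo k ≡ suc (count Q? lo k)
  count-remove zero p∈ _ _ _ = contradiction p∈ range-empty
  count-remove {lo} (suc k) {p} p∈ Pp ¬Qp P⇔Q with lo ≟ p
  ... | yes refl with P? lo | Q? lo
  ...   | no ¬Pp | _      = contradiction Pp ¬Pp
  ...   | _      | yes Qp = contradiction Qp ¬Qp
  ...   | yes _  | no _   = cong suc (count-cong k (λ i∈ → P⇔Q (range-suc i∈) (>⇒≢ (proj₁ i∈))))
  count-remove {lo} (suc k) {p} p∈ Pp ¬Qp P⇔Q | no lo≢p = begin
    𝟙 (P? lo) + count P? (suc lo) k         ≡⟨ cong₂ _+_ (𝟙-cong (P? lo) (Q? lo) (P⇔Q (lo∈range lo k) lo≢p)) rest ⟩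
    𝟙 (Q? lo) + suc (count Q? (suc lo) k)   ≡⟨ +-suc (𝟙 (Q? lo)) _ ⟩
    suc (count Q? lo (suc k))               ∎
    where
    open ≡-Reasoning
    rest : count P? (suc lo) k ≡ suc (count Q? (suc lo) k)
    rest = count-remove k (range-pred p∈ (lo≢p ∘ sym)) Pp ¬Qp (P⇔Q ∘ range-suc)

count-unique : ∀ {P : ℕ → Set} (P? : Decidable P) {lo} k {p} →
               (∀ {i j} → InRange lo k i → InRange lo k j → P i → P j → i ≡ j) →
               InRange lo k p → P p → count P? lo k ≡ 1
count-unique P? k unique p∈ Pp =
  trans (count-remove P? ∅? k p∈ Pp (λ ()) (λ i∈ i≢p → mk⇔ (λ Pi → i≢p (unique i∈ p∈ Pi Pp)) λ ()))
        (cong suc (count-none ∅? k (λ _ ())))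
  where
  ∅? : Decidable {A = ℕ} (λ _ → ⊥)
  ∅? _ = no λ ()

count-multiples-window : ∀ a {lo k p} → k ≤ a → InRange lo k p → a ∣ p → count (a ∣?_) lo k ≡ 1
count-multiples-window a {lo} {k} k≤a p∈ a∣p = count-unique (a ∣?_) k unique p∈ a∣p
  where
  ordered : ∀ {i j} → InRange lo k j → lo ≤ i → i ≤ j → a ∣ i → a ∣ j → i ≡ j
  ordered {i} (_ , j<lo+k) lo≤i i≤j a∣i a∣j with m≤n⇒∃[o]m+o≡n i≤j
  ... | zero  , i+0≡j = trans (sym (+-identityʳ i)) i+0≡j
  ... | suc o , i+o≡j = contradiction a∣o (>⇒∤ (<-≤-trans o<k k≤a))
    where
    a∣o : a ∣ suc o
    a∣o = ∣m+n∣m⇒∣n (subst (a ∣_) (sym i+o≡j) a∣j) a∣i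
    o<k : suc o < k
    o<k = +-cancelˡ-< i (suc o) k (<-≤-trans (subst (_< lo + k) (sym i+o≡j) j<lo+k) (+-monoˡ-≤ k lo≤i))
  unique : ∀ {i j} → InRange lo k i → InRange lo k j → a ∣ i → a ∣ j → i ≡ j
  unique {i} {j} i∈ j∈ a∣i a∣j with ≤-total i j
  ... | inj₁ i≤j = ordered j∈ (proj₁ i∈) i≤j a∣i a∣j
  ... | inj₂ j≤i = sym (ordered i∈ (proj₁ j∈) j≤i a∣j a∣i)

count-multiples : ∀ a q r → r < a → count (a ∣?_) 0 (suc (r + q * a)) ≡ suc q
count-multiples a zero    r r<a =
  count-multiples-window a (subst (λ x → suc x ≤ a) (sym (+-identityʳ r)) r<a) (z≤n , s≤s z≤n) (a ∣0)
count-multiples a (suc q) r r<a = begin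
  count (a ∣?_) 0 (suc (r + suc q * a))                              ≡⟨ cong (count (a ∣?_) 0) (regroup r q a) ⟩
  count (a ∣?_) 0 (suc (r + q * a) + a)                              ≡⟨ ∑-split (𝟙 ∘ (a ∣?_)) 0 (suc (r + q * a)) a ⟩
  count (a ∣?_) 0 (suc (r + q * a)) + count (a ∣?_) (suc (r + q * a)) a
                                                                     ≡⟨ cong₂ _+_ (count-multiples a q r r<a) next-block ⟩
  suc q + 1                                                          ≡⟨ +-comm (suc q) 1 ⟩
  suc (suc q)                                                        ∎
  where
  open ≡-Reasoning
  regroup : ∀ r q a → suc (r + suc q * a) ≡ suc (r + q * a) + a
  regroup = solve-∀
  next∈ : InRange (suc (r + q * a)) a (suc q * a)
  next∈ = +-monoˡ-≤ (q * a) r<a , s≤s (subst (_≤ r + q * a + a) (+-comm (q * a) a) (+-monoˡ-≤ a (m≤n+m (q * a) r)))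
  next-block : count (a ∣?_) (suc (r + q * a)) a ≡ 1
  next-block = count-multiples-window a ≤-refl next∈ (n∣m*n (suc q))

members : {P : ℕ → Set} → Decidable P → ℕ → ℕ → List ℕ
members P? lo zero    = []
members P? lo (suc k) with P? lo
... | yes _ = lo ∷ members P? (suc lo) k
... | no _  = members P? (suc lo) k

module _ {P : ℕ → Set} (P? : Decidable P) where

  length-members : ∀ lo k → length (members P? lo k) ≡ count P? lo k
  length-members lo zero    = refl
  length-members lo (suc k) with P? lo
  ... | yes _ = cong suc (length-members (suc lo) k)
  ... | no _  = length-members (suc lo) k

  ∈-members⁻ : ∀ lo k {n} → n ∈ members P? lo k → InRange lo k n × P n
  ∈-members⁻ lo (suc k) n∈ with P? lo | n∈
  ... | yes Plo | here refl = lo∈range lo k , Plo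
  ... | yes _   | there n∈′ = let (n∈r , Pn) = ∈-members⁻ (suc lo) k n∈′ in range-suc n∈r , Pn
  ... | no _    | n∈′       = let (n∈r , Pn) = ∈-members⁻ (suc lo) k n∈′ in range-suc n∈r , Pn

  ∈-members⁺ : ∀ lo k {n} → InRange lo k n → P n → n ∈ members P? lo k
  ∈-members⁺ lo zero    n∈ _  = contradiction n∈ range-empty
  ∈-members⁺ lo (suc k) {n} n∈ Pn with P? lo | n ≟ lo
  ... | yes _   | yes refl = here refl
  ... | yes _   | no n≢lo  = there (∈-members⁺ (suc lo) k (range-pred n∈ n≢lo) Pn)
  ... | no ¬Plo | yes refl = contradiction Pn ¬Plo
  ... | no _    | no n≢lo  = ∈-members⁺ (suc lo) k (range-pred n∈ n≢lo) Pn

  members-unique : ∀ lo k → Unique (members P? lo k)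
  members-unique lo zero    = AllPairs.[]
  members-unique lo (suc k) with P? lo
  ... | yes _ = All.tabulate (λ n∈ → <⇒≢ (proj₁ (proj₁ (∈-members⁻ (suc lo) k n∈))))
                AllPairs.∷ members-unique (suc lo) k
  ... | no _  = members-unique (suc lo) k

-- Sums of distinct naturals below a bound

_without_ : List ℕ → ℕ → List ℕ
xs without m = filter (λ x → ¬? (x ≟ m)) xs

without-∈ : ∀ {xs m} → Unique xs → m ∈ xs →
            length xs ≡ suc (length (xs without m)) × sum xs ≡ m + sum (xs without m)
without-∈ {x ∷ xs} {m} (x∉xs AllPairs.∷ u) m∈ with x ≟ m | m∈
... | yes refl | _
  rewrite filter-reject (λ y → ¬? (y ≟ m)) {xs = xs} (λ m≢m → m≢m refl)
        | filter-all (λ y → ¬? (y ≟ m)) (All.map ≢-sym x∉xs) = refl , refl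
... | no x≢m   | here m≡x = contradiction (sym m≡x) x≢m
... | no x≢m   | there m∈′ rewrite filter-accept (λ y → ¬? (y ≟ m)) {xs = xs} x≢m =
  let (length≡ , sum≡) = without-∈ u m∈′
  in cong suc length≡ , trans (cong (x +_) sum≡) (x∙yz≈y∙xz x m _)

∈-without⁻ : ∀ {xs m x} → x ∈ xs without m → x ∈ xs × x ≢ m
∈-without⁻ {m = m} = ∈-filter⁻ (λ y → ¬? (y ≟ m))

without-unique : ∀ {xs} m → Unique xs → Unique (xs without m)
without-unique m = Unique.filter⁺ (λ y → ¬? (y ≟ m))

distinct-sum-bounds : ∀ m {xs} → Unique xs → (∀ {x} → x ∈ xs → x < m) →
                      length xs ≤ m ×
                      length xs * length xs ≤ 2 * sum xs + length xs ×
                      2 * sum xs + length xs * suc (length xs) ≤ 2 * m * length xs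
distinct-sum-bounds zero    {[]}    _ _     = z≤n , z≤n , z≤n
distinct-sum-bounds zero    {_ ∷ _} _ below = contradiction (below (here refl)) λ ()
distinct-sum-bounds (suc m) {xs} u below with m DecMembership.∈? xs
... | no m∉ =
  let (n≤m , lower , upper) = distinct-sum-bounds m u (λ x∈ → ≤∧≢⇒< (≤-pred (below x∈)) λ { refl → m∉ x∈ })
  in m≤n⇒m≤1+n n≤m , lower , ≤-trans upper (*-monoˡ-≤ (length xs) (*-monoʳ-≤ 2 (n≤1+n m)))
... | yes m∈ with without-∈ u m∈
...   | length≡ , sum≡ rewrite length≡ | sum≡ =
  let (k≤m , lower , upper) = distinct-sum-bounds m (without-unique m u) below′
      k = length (xs without m)
      s = sum (xs without m)
  in s≤s k≤m ,
     (begin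
       suc k * suc k               ≡⟨ square-suc k ⟩
       k * k + (k + k) + 1         ≤⟨ +-monoˡ-≤ 1 (+-mono-≤ lower (+-mono-≤ k≤m k≤m)) ⟩
       2 * s + k + (m + m) + 1     ≡⟨ regroup-lower s k m ⟩
       2 * (m + s) + suc k         ∎) ,
     (begin
       2 * (m + s) + suc k * suc (suc k)           ≡⟨ regroup-upper m s k ⟩
       2 * s + k * suc k + (2 * m + 2 * k + 2)     ≤⟨ +-monoˡ-≤ _ upper ⟩
       2 * m * k + (2 * m + 2 * k + 2)             ≡⟨ regroup-bound m k ⟩
       2 * suc m * suc k                           ∎)
  where
  open ≤-Reasoning
  below′ : ∀ {x} → x ∈ xs without m → x < m
  below′ x∈ = let (x∈xs , x≢m) = ∈-without⁻ x∈ in ≤∧≢⇒< (≤-pred (below x∈xs)) x≢m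
  square-suc : ∀ k → suc k * suc k ≡ k * k + (k + k) + 1
  square-suc = solve-∀
  regroup-lower : ∀ s k m → 2 * s + k + (m + m) + 1 ≡ 2 * (m + s) + suc k
  regroup-lower = solve-∀
  regroup-upper : ∀ m s k → 2 * (m + s) + suc k * suc (suc k) ≡ 2 * s + k * suc k + (2 * m + 2 * k + 2)
  regroup-upper = solve-∀
  regroup-bound : ∀ m k → 2 * m * k + (2 * m + 2 * k + 2) ≡ 2 * suc m * suc k
  regroup-bound = solve-∀

length-without : ∀ {xs} m → Unique xs → length xs ≤ suc (length (xs without m))
length-without {xs} m u with m DecMembership.∈? xs
... | yes m∈ = ≤-reflexive (proj₁ (without-∈ u m∈))
... | no m∉  = subst (λ ys → length xs ≤ suc (length ys)) (sym xs-without-m≡xs) (n≤1+n _)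
  where
  xs-without-m≡xs : xs without m ≡ xs
  xs-without-m≡xs = filter-all (λ y → ¬? (y ≟ m)) (All.tabulate λ {x} x∈ x≡m → m∉ (subst (_∈ xs) x≡m x∈))

sum-applyUpTo : ∀ f k → sum (applyUpTo f k) ≡ ∑ f 0 k
sum-applyUpTo f zero    = refl
sum-applyUpTo f (suc k) = cong (f 0 +_) (trans (sum-applyUpTo (f ∘ suc) k) (sym (∑-shift f 1 0 k)))

injective-sum-bounds : ∀ f m k → (∀ {i} → i < k → f i < m) → (∀ {i j} → i < k → j < k → f i ≡ f j → i ≡ j) →
                       k * k ≤ 2 * ∑ f 0 k + k × 2 * ∑ f 0 k + k * suc k ≤ 2 * m * k
injective-sum-bounds f m k below injective =
  subst₂ (λ n s → n * n ≤ 2 * s + n) (length-applyUpTo f k) (sum-applyUpTo f k) (proj₁ (proj₂ bounds)) ,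
  subst₂ (λ n s → 2 * s + n * suc n ≤ 2 * m * n) (length-applyUpTo f k) (sum-applyUpTo f k) (proj₂ (proj₂ bounds))
  where
  distinct : Unique (applyUpTo f k)
  distinct = Unique.applyUpTo⁺₁ f k (λ i<j j<k → <⇒≢ i<j ∘ injective (<-trans i<j j<k) j<k)
  values-below : ∀ {x} → x ∈ applyUpTo f k → x < m
  values-below x∈ with ∈-applyUpTo⁻ f x∈
  ... | i , i<k , refl = below i<k
  bounds : let xs = applyUpTo f k in
           length xs ≤ m × length xs * length xs ≤ 2 * sum xs + length xs ×
           2 * sum xs + length xs * suc (length xs) ≤ 2 * m * length xs
  bounds = distinct-sum-bounds m distinct values-below

-- Ordinarization of a set with finitely many gaps

module Search {P : ℕ → Set} (P? : Decidable P) where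

  private
    extend : ∀ {B} → (∀ {k} → k < B → ¬ P k) → ¬ P B → ∀ {k} → k < suc B → ¬ P k
    extend none ¬PB k<1+B = [ none , (λ { refl → ¬PB }) ]′ (m<1+n⇒m<n∨m≡n k<1+B)

    first : ∀ B → (∀ {k} → k < B → ¬ P k) ⊎ ∃[ m ] (m < B × P m × ∀ {k} → k < m → ¬ P k)
    first zero = inj₁ λ ()
    first (suc B) with first B
    ... | inj₂ (m , m<B , Pm , below) = inj₂ (m , m<n⇒m<1+n m<B , Pm , below)
    ... | inj₁ none with P? B
    ...   | yes PB  = inj₂ (B , n<1+n B , PB , none)
    ...   | no ¬PB  = inj₁ (extend none ¬PB)

    last : ∀ B → (∀ {k} → k < B → ¬ P k) ⊎ ∃[ m ] (m < B × P m × ∀ {k} → m < k → k < B → ¬ P k)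
    last zero = inj₁ λ ()
    last (suc B) with P? B
    ... | yes PB = inj₂ (B , n<1+n B , PB , λ B<k k<1+B → contradiction (≤-pred k<1+B) (<⇒≱ B<k))
    ... | no ¬PB with last B
    ...   | inj₁ none = inj₁ (extend none ¬PB)
    ...   | inj₂ (m , m<B , Pm , above) =
      inj₂ (m , m<n⇒m<1+n m<B , Pm , λ m<k k<1+B → [ above m<k , (λ { refl → ¬PB }) ]′ (m<1+n⇒m<n∨m≡n k<1+B))

  least : ∀ {n} → P n → ∃[ m ] (m ≤ n × P m × ∀ {k} → k < m → ¬ P k)
  least {n} Pn with first (suc n)
  ... | inj₁ none                     = contradiction Pn (none (n<1+n n))
  ... | inj₂ (m , m<1+n , Pm , below) = m , ≤-pred m<1+n , Pm , below

  greatest : ∀ {B n} → n < B → P n → ∃[ m ] (n ≤ m × m < B × P m × ∀ {k} → m < k → k < B → ¬ P k)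
  greatest {B} n<B Pn with last B
  ... | inj₁ none                   = contradiction Pn (none n<B)
  ... | inj₂ (m , m<B , Pm , above) = m , ≮⇒≥ (λ m<n → above m<n n<B Pn) , m<B , Pm , above

module OrdinarizationStep (g d : ℕ) {P : ℕ → Set} (P? : Decidable P) (P0 : P 0)
                          (large : ∀ {n} → suc g + d ≤ n → P n) where

  no-elements-no-gaps⇒ordinary : count P? 1 g ≡ 0 → count (¬? ∘ P?) (suc g) d ≡ 0 → Ordinary g ≐ P
  no-elements-no-gaps⇒ordinary no-elements no-gaps n = ordinary⇒P n , P⇒ordinary n
    where
    ordinary⇒P : ∀ n → Ordinary g n → P n
    ordinary⇒P n (inj₁ refl) = P0
    ordinary⇒P n (inj₂ g<n) with n <? suc g + d
    ... | yes n<N = decidable-stable (P? n) (count≡0⇒¬ (¬? ∘ P?) d no-gaps (g<n , n<N))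
    ... | no n≮N  = large (≮⇒≥ n≮N)
    P⇒ordinary : ∀ n → P n → Ordinary g n
    P⇒ordinary zero    _  = inj₁ refl
    P⇒ordinary (suc n) Pn with g <? suc n
    ... | yes g<n = inj₂ g<n
    ... | no g≮n  = contradiction Pn (count≡0⇒¬ P? g no-elements (s≤s z≤n , s≤s (≮⇒≥ g≮n)))

  step : ∀ μ → count P? 1 g ≡ suc μ → count (¬? ∘ P?) (suc g) d ≡ suc μ →
         Σ (ℕ → Set) λ U → Σ (Decidable U) λ U? →
           Step P U × U 0 × (∀ {n} → suc g + d ≤ n → U n) × count U? 1 g ≡ μ × count (¬? ∘ U?) (suc g) d ≡ μ
  step μ elements gaps
    with count>0⇒∃ P? g (subst (0 <_) (sym elements) (s≤s z≤n))
       | count>0⇒∃ (¬? ∘ P?) d (subst (0 <_) (sym gaps) (s≤s z≤n))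
  ... | i , (i>0 , i<1+g) , Pi | j , (g<j , j<N) , ¬Pj
    with Search.least (λ n → (0 <? n) ×-dec P? n) (i>0 , Pi) | Search.greatest (¬? ∘ P?) j<N ¬Pj
  ... | m , m≤i , (m>0 , Pm) , below-m | f , j≤f , f<N , ¬Pf , above-f =
    U , U? , (f , m , (¬Pf , f-max) , (m>0 , Pm , m-min) , λ _ → (λ Un → Un) , (λ Un → Un)) ,
    (inj₁ P0 , <⇒≢ m>0) , U-large , elements′ , gaps′
    where
    m≤g : m ≤ g
    m≤g = ≤-trans m≤i (≤-pred i<1+g)
    g<f : g < f
    g<f = <-≤-trans g<j j≤f
    f-max : ∀ n → ¬ P n → n ≤ f
    f-max n ¬Pn with n ≤? f
    ... | yes n≤f = n≤f
    ... | no n≰f with n <? suc g + d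
    ...   | yes n<N = contradiction ¬Pn (above-f (≰⇒> n≰f) n<N)
    ...   | no n≮N  = contradiction (large (≮⇒≥ n≮N)) ¬Pn
    m-min : ∀ n → 0 < n → P n → m ≤ n
    m-min n n>0 Pn = ≮⇒≥ λ n<m → below-m n<m (n>0 , Pn)
    U : ℕ → Set
    U n = (P n ⊎ n ≡ f) × n ≢ m
    U? : Decidable U
    U? n = (P? n ⊎-dec n ≟ f) ×-dec ¬? (n ≟ m)
    U-large : ∀ {n} → suc g + d ≤ n → U n
    U-large N≤n = inj₁ (large N≤n) , >⇒≢ (<-≤-trans (s≤s (≤-trans m≤g (m≤m+n g d))) N≤n)
    elements′ : count U? 1 g ≡ μ
    elements′ = suc-injective (trans (sym (count-remove P? U? g (m>0 , s≤s m≤g) Pm (λ (_ , m≢m) → m≢m refl) agree))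
                                     elements)
      where
      agree : ∀ {n} → InRange 1 g n → n ≢ m → P n ⇔ U n
      agree (_ , n<1+g) n≢m = mk⇔ (λ Pn → inj₁ Pn , n≢m)
        λ { (inj₁ Pn , _) → Pn ; (inj₂ refl , _) → contradiction g<f (≤⇒≯ (≤-pred n<1+g)) }
    gaps′ : count (¬? ∘ U?) (suc g) d ≡ μ
    gaps′ = suc-injective (trans (sym (count-remove (¬? ∘ P?) (¬? ∘ U?) d (g<f , f<N) ¬Pf (λ ¬Uf → ¬Uf (inj₂ refl , f≢m))
                                                   agree))
                                 gaps)
      where
      f≢m : f ≢ m
      f≢m = >⇒≢ (≤-<-trans m≤g g<f)
      agree : ∀ {n} → InRange (suc g) d n → n ≢ f → (¬ P n) ⇔ (¬ U n)
      agree (g<n , _) n≢f = mk⇔ (λ { ¬Pn (inj₁ Pn , _) → ¬Pn Pn ; ¬Pn (inj₂ n≡f , _) → n≢f n≡f })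
                                 (λ ¬Un Pn → ¬Un (inj₁ Pn , >⇒≢ (≤-<-trans m≤g g<n)))

ordinarize : ∀ μ g d {P : ℕ → Set} (P? : Decidable P) → P 0 → (∀ {n} → suc g + d ≤ n → P n) →
             count P? 1 g ≡ μ → count (¬? ∘ P?) (suc g) d ≡ μ → Iter μ P (Ordinary g)
ordinarize zero    g d P? P0 large elements gaps =
  lift (OrdinarizationStep.no-elements-no-gaps⇒ordinary g d P? P0 large elements gaps)
ordinarize (suc μ) g d P? P0 large elements gaps with OrdinarizationStep.step g d P? P0 large μ elements gaps
... | U , U? , P→U , U0 , U-large , elements′ , gaps′ = U , P→U , ordinarize μ g d U? U0 U-large elements′ gaps′

iteration-length-bound : ∀ k {g} {T : SubsetN} → Iter k T (Ordinary g) → ∀ xs → Unique xs →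
                         (∀ {x} → x ∈ xs → 0 < x × x ≤ g × T x) → length xs ≤ k
iteration-length-bound zero    _        []      _ _         = z≤n
iteration-length-bound zero    (lift T≐) (x ∷ _) _ elements with elements (here refl)
... | x>0 , x≤g , Tx with proj₂ (T≐ x) Tx
...   | inj₁ refl = contradiction x>0 λ ()
...   | inj₂ g<x  = contradiction g<x (≤⇒≯ x≤g)
iteration-length-bound (suc k) {g} (V , (_ , m , _ , _ , V≐) , it) xs u elements =
  ≤-trans (length-without m u) (s≤s (iteration-length-bound k it (xs without m) (without-unique m u) elements′))
  where
  elements′ : ∀ {x} → x ∈ xs without m → 0 < x × x ≤ g × V x
  elements′ x∈ with ∈-without⁻ x∈
  ... | x∈xs , x≢m with elements x∈xs
  ...   | x>0 , x≤g , Tx = x>0 , x≤g , proj₂ (V≐ _) (inj₁ Tx , x≢m)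

ordinarization-number : ∀ {P : ℕ → Set} (P? : Decidable P) N → P 0 → (∀ {n} → N ≤ n → P n) →
                        IsOrdinarizationNumber P (count P? 1 (count (¬? ∘ P?) 0 N))
ordinarization-number {P} P? N P0 large = g , genus , iteration , minimal
  where
  g μ d : ℕ
  g = count (¬? ∘ P?) 0 N
  μ = count P? 1 g
  d = N ∸ g
  gap<N : ∀ {n} → ¬ P n → n < N
  gap<N ¬Pn = ≰⇒> (¬Pn ∘ large)
  genus : HasGenus P g
  genus = members (¬? ∘ P?) 0 N , members-unique (¬? ∘ P?) 0 N ,
          (λ n → proj₂ ∘ ∈-members⁻ (¬? ∘ P?) 0 N , λ ¬Pn → ∈-members⁺ (¬? ∘ P?) 0 N (z≤n , gap<N ¬Pn) ¬Pn) ,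
          length-members (¬? ∘ P?) 0 N
  -- As g ≤ N, the range [0, N] splits into {0}, [1, g] and [g + 1, g + d]
  1+N≡1+g+d : suc N ≡ suc g + d
  1+N≡1+g+d = cong suc (sym (m+[n∸m]≡n (subst (g ≤_) (count-complement P? 0 N) (m≤n+m g _))))
  gaps-below : count (¬? ∘ P?) 1 g + count (¬? ∘ P?) (suc g) d ≡ g
  gaps-below = begin
    count (¬? ∘ P?) 1 g + count (¬? ∘ P?) (suc g) d         ≡⟨ cong (λ x → x + count (¬? ∘ P?) 1 g + gaps-above-g) 0∉gaps ⟩
    count (¬? ∘ P?) 0 (suc g) + count (¬? ∘ P?) (suc g) d   ≡⟨ sym (∑-split _ 0 (suc g) d) ⟩
    count (¬? ∘ P?) 0 (suc g + d)                          ≡⟨ cong (count (¬? ∘ P?) 0) (sym 1+N≡1+g+d) ⟩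
    count (¬? ∘ P?) 0 (suc N)                              ≡⟨ ∑-snoc _ 0 N ⟩
    g + 𝟙 (¬? (P? N))                                      ≡⟨ cong (g +_) N∉gaps ⟩
    g + 0                                                  ≡⟨ +-identityʳ g ⟩
    g                                                      ∎
    where
    open ≡-Reasoning
    gaps-above-g : ℕ
    gaps-above-g = count (¬? ∘ P?) (suc g) d
    0∉gaps : 0 ≡ 𝟙 (¬? (P? 0))
    0∉gaps = sym (𝟙-no (¬? (P? 0)) (λ ¬P0 → ¬P0 P0))
    N∉gaps : 𝟙 (¬? (P? N)) ≡ 0
    N∉gaps = 𝟙-no (¬? (P? N)) (λ ¬PN → ¬PN (large ≤-refl))
  gaps-above : count (¬? ∘ P?) (suc g) d ≡ μ
  gaps-above = +-cancelˡ-≡ (count (¬? ∘ P?) 1 g) _ _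
    (trans gaps-below (trans (sym (count-complement P? 1 g)) (+-comm μ _)))
  iteration : Iter μ P (Ordinary g)
  iteration = ordinarize μ g d P? P0 (λ 1+g+d≤n → large (≤-trans (subst (N ≤_) 1+N≡1+g+d (n≤1+n N)) 1+g+d≤n))
                         refl gaps-above
  minimal : ∀ k → k < μ → ¬ Iter k P (Ordinary g)
  minimal k k<μ it = <⇒≱ k<μ (subst (_≤ k) (length-members P? 1 g)
    (iteration-length-bound k it (members P? 1 g) (members-unique P? 1 g) λ x∈ →
      let ((x>0 , x<1+g) , Px) = ∈-members⁻ P? 1 g x∈ in x>0 , ≤-pred x<1+g , Px))

-- Semigroups generated by two coprime numbers

cancel-multiples : ∀ {a x n R Q} → x + R * a ≡ n + Q * a → (∃[ k ] n ≡ k * a + x) ⊎ (∃[ k ] n + suc k * a ≡ x)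
cancel-multiples {a} {x} {n} {R} {Q} eq with compare R Q
... | less .R k    = inj₂ (k , sym (+-cancelʳ-≡ (R * a) x _ (trans eq (shift n R k a))))
  where
  shift : ∀ n R k a → n + suc (R + k) * a ≡ n + suc k * a + R * a
  shift = solve-∀
... | equal .R     = inj₁ (0 , sym (+-cancelʳ-≡ (R * a) x n eq))
... | greater Q k  = inj₁ (suc k , +-cancelʳ-≡ (Q * a) n _ (trans (sym eq) (shift x Q k a)))
  where
  shift : ∀ x Q k a → x + suc (Q + k) * a ≡ suc k * a + x + Q * a
  shift = solve-∀

module TwoGenerated (a₁ b₁ : ℕ) (a⊥b : Coprime (suc a₁) (suc b₁)) where

  a b c : ℕ
  a = suc a₁
  b = suc b₁
  c = a₁ * b₁

  S : SubsetN
  S = ⟨ a , b ⟩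

  Rep : ℕ → ℕ → Set
  Rep y n = ∃[ x ] n ≡ x * a + y * b

  Rep⇒S : ∀ {y n} → Rep y n → S n
  Rep⇒S {y} (x , n≡) = x , y , n≡

  S⇒Rep : ∀ {n} → S n → ∃[ y ] (y < a × Rep y n)
  S⇒Rep {n} (x , y , n≡) = y % a , m%n<n y a , x + y / a * b , (begin
    n                                ≡⟨ n≡ ⟩
    x * a + y * b                    ≡⟨ cong (λ z → x * a + z * b) (m≡m%n+[m/n]*n y a) ⟩
    x * a + (y % a + y / a * a) * b  ≡⟨ regroup x (y % a) (y / a) a b ⟩
    (x + y / a * b) * a + y % a * b  ∎)
    where
    open ≡-Reasoning
    regroup : ∀ x r q a b → x * a + (r + q * a) * b ≡ (x + q * b) * a + r * b
    regroup = solve-∀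

  Rep? : ∀ y → Decidable (Rep y)
  Rep? y n = map′ from to ((y * b ≤? n) ×-dec (a ∣? (n ∸ y * b)))
    where
    from : y * b ≤ n × a ∣ n ∸ y * b → Rep y n
    from (yb≤n , divides x n∸yb≡xa) = x , trans (sym (m∸n+n≡m yb≤n)) (cong (_+ y * b) n∸yb≡xa)
    to : Rep y n → y * b ≤ n × a ∣ n ∸ y * b
    to (x , n≡) = subst (λ n → y * b ≤ n × a ∣ n ∸ y * b) (sym n≡)
                        (m≤n+m (y * b) (x * a) , divides x (m+n∸n≡m (x * a) (y * b)))

  S? : Decidable S
  S? n = map′ (λ (y , _ , rep) → Rep⇒S {y} rep) S⇒Rep (anyUpTo? (λ y → Rep? y n) a)

  private
    distinct-reps : ∀ {y d x x′} → y + suc d < a → x * a + y * b ≢ x′ * a + (y + suc d) * b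
    distinct-reps {y} {d} {x} {x′} y+1+d<a eq = >⇒∤ (≤-<-trans (m≤n+m (suc d) y) y+1+d<a) a∣1+d
      where
      xa≡ : x * a ≡ x′ * a + suc d * b
      xa≡ = +-cancelʳ-≡ (y * b) _ _ (trans eq (regroup x′ a y (suc d) b))
        where
        regroup : ∀ x′ a y e b → x′ * a + (y + e) * b ≡ x′ * a + e * b + y * b
        regroup = solve-∀
      a∣1+d : a ∣ suc d
      a∣1+d = coprime-divisor a⊥b (subst (a ∣_) (*-comm (suc d) b)
                (∣m+n∣m⇒∣n (subst (a ∣_) xa≡ (n∣m*n x)) (n∣m*n x′)))

    rep-unique-≤ : ∀ {y y′ x x′} → y′ < a → x * a + y * b ≡ x′ * a + y′ * b → y ≤ y′ → y ≡ y′
    rep-unique-≤ {x = x} {x′} y′<a eq y≤y′ with m≤n⇒∃[o]m+o≡n y≤y′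
    ... | zero  , refl = sym (+-identityʳ _)
    ... | suc d , refl = contradiction eq (distinct-reps {x = x} {x′} y′<a)

  rep-unique : ∀ {y₁ y₂ n} → y₁ < a → y₂ < a → Rep y₁ n → Rep y₂ n → y₁ ≡ y₂
  rep-unique {y₁} {y₂} y₁<a y₂<a (x₁ , n≡₁) (x₂ , n≡₂) with ≤-total y₁ y₂
  ... | inj₁ y₁≤y₂ = rep-unique-≤ {x = x₁} {x₂} y₂<a (trans (sym n≡₁) n≡₂) y₁≤y₂
  ... | inj₂ y₂≤y₁ = sym (rep-unique-≤ {x = x₂} {x₁} y₁<a (trans (sym n≡₂) n≡₁) y₂≤y₁)

  private
    times-b-onto : ∀ n → ∃[ Y ] ∃[ P ] ∃[ Q ] Y * b + P * a ≡ n + Q * a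
    times-b-onto n with coprime-Bézout a⊥b
    ... | Bézout.-+ x y 1+xa≡yb = n * y , 0 , n * x , (begin
      n * y * b + 0        ≡⟨ regroup n y b ⟩
      n * (y * b)          ≡⟨ cong (n *_) (sym 1+xa≡yb) ⟩
      n * (1 + x * a)      ≡⟨ expand n x a ⟩
      n + n * x * a        ∎)
      where
      open ≡-Reasoning
      regroup : ∀ n y b → n * y * b + 0 ≡ n * (y * b)
      regroup = solve-∀
      expand : ∀ n x a → n * (1 + x * a) ≡ n + n * x * a
      expand = solve-∀
    ... | Bézout.+- x y 1+yb≡xa = n * a₁ * y , n , n * a₁ * x , (begin
      n * a₁ * y * b + n * suc a₁    ≡⟨ regroup n a₁ y b ⟩
      n * a₁ * (1 + y * b) + n       ≡⟨ cong (λ z → n * a₁ * z + n) 1+yb≡xa ⟩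
      n * a₁ * (x * suc a₁) + n      ≡⟨ expand n a₁ x ⟩
      n + n * a₁ * x * suc a₁        ∎)
      where
      open ≡-Reasoning
      regroup : ∀ n a₁ y b → n * a₁ * y * b + n * suc a₁ ≡ n * a₁ * (1 + y * b) + n
      regroup = solve-∀
      expand : ∀ n a₁ x → n * a₁ * (x * suc a₁) + n ≡ n + n * a₁ * x * suc a₁
      expand = solve-∀

  congruent-multiple-of-b : ∀ n → ∃[ y ] (y < a × (Rep y n ⊎ ∃[ k ] n + suc k * a ≡ y * b))
  congruent-multiple-of-b n with times-b-onto n
  ... | Y , P , Q , eq = Y % a , m%n<n Y a , cancel-multiples {R = Y / a * b + P} {Q} (trans reduce eq)
    where
    regroup : ∀ r q P a b → r * b + (q * b + P) * a ≡ (r + q * a) * b + P * a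
    regroup = solve-∀
    reduce : Y % a * b + (Y / a * b + P) * a ≡ Y * b + P * a
    reduce = trans (regroup (Y % a) (Y / a) P a b) (cong (λ z → z * b + P * a) (sym (m≡m%n+[m/n]*n Y a)))

  conductor : ∀ {n} → c ≤ n → S n
  conductor {n} c≤n with congruent-multiple-of-b n
  ... | y , _   , inj₁ rep = Rep⇒S {y} rep
  ... | y , y<a , inj₂ (k , n+≡yb) = contradiction (*-monoˡ-≤ b (≤-pred y<a)) (<⇒≱ a₁b<yb)
    where
    open ≤-Reasoning
    a₁b<yb : a₁ * b < y * b
    a₁b<yb = begin-strict
      a₁ * b          ≡⟨ *-suc a₁ b₁ ⟩
      a₁ + c          <⟨ +-monoˡ-< c (n<1+n a₁) ⟩
      a + c           ≤⟨ +-mono-≤ (m≤m+n a (k * a)) c≤n ⟩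
      suc k * a + n   ≡⟨ +-comm _ n ⟩
      n + suc k * a   ≡⟨ n+≡yb ⟩
      y * b           ∎

  private
    ab-not-sum : ∀ x y → suc x * a + suc y * b ≢ a * b
    ab-not-sum x y eq = <⇒≢ ab<sum (sym eq)
      where
      b∣1+x : b ∣ suc x
      b∣1+x = coprime-divisor (Coprime.sym a⊥b) (subst (b ∣_) (*-comm (suc x) a)
                (∣m+n∣m⇒∣n (subst (b ∣_) (trans (sym eq) (+-comm (suc x * a) (suc y * b))) (n∣m*n a)) (n∣m*n (suc y))))
      ab<sum : a * b < suc x * a + suc y * b
      ab<sum = begin-strict
        a * b                       ≡⟨ *-comm a b ⟩
        b * a                       ≤⟨ *-monoˡ-≤ a (∣⇒≤ b∣1+x) ⟩
        suc x * a                   <⟨ m<m+n _ (s≤s z≤n) ⟩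
        suc x * a + suc y * b       ∎
        where open ≤-Reasoning

    mirror-sum : ∀ {n} → n < c → n + (c ∸ suc n) + a + b ≡ a * b
    mirror-sum {n} n<c = begin
      n + (c ∸ suc n) + a + b          ≡⟨ regroup n (c ∸ suc n) a₁ b₁ ⟩
      suc n + (c ∸ suc n) + a₁ + b     ≡⟨ cong (λ z → z + a₁ + b) (m+[n∸m]≡n n<c) ⟩
      c + a₁ + b                       ≡⟨ expand a₁ b₁ ⟩
      a * b                            ∎
      where
      open ≡-Reasoning
      regroup : ∀ n m a₁ b₁ → n + m + suc a₁ + suc b₁ ≡ suc n + m + a₁ + suc b₁
      regroup = solve-∀
      expand : ∀ a₁ b₁ → a₁ * b₁ + a₁ + suc b₁ ≡ suc a₁ * suc b₁
      expand = solve-∀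

  gap⇔mirror-element : ∀ {n} → n < c → (¬ S n) ⇔ S (c ∸ suc n)
  gap⇔mirror-element {n} n<c = mk⇔ gap⇒mirror mirror⇒gap
    where
    m : ℕ
    m = c ∸ suc n
    gap⇒mirror : ¬ S n → S m
    gap⇒mirror ¬Sn with congruent-multiple-of-b n
    ... | y , _   , inj₁ rep = contradiction (Rep⇒S {y} rep) ¬Sn
    ... | y , y<a , inj₂ (k , n+≡yb) with m≤n⇒∃[o]m+o≡n (≤-pred y<a)
    ...   | z , y+z≡a₁ = k , z , +-cancelˡ-≡ (n + a + b) _ _ (begin
      n + a + b + m                 ≡⟨ regroup n a b m ⟩
      n + m + a + b                 ≡⟨ mirror-sum n<c ⟩
      suc a₁ * b                    ≡⟨ cong (λ w → suc w * b) (sym y+z≡a₁) ⟩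
      suc (y + z) * b               ≡⟨ expand y z b ⟩
      y * b + z * b + b             ≡⟨ cong (λ w → w + z * b + b) (sym n+≡yb) ⟩
      n + suc k * a + z * b + b     ≡⟨ collect n k a z b ⟩
      n + a + b + (k * a + z * b)   ∎)
      where
      open ≡-Reasoning
      regroup : ∀ n a b m → n + a + b + m ≡ n + m + a + b
      regroup = solve-∀
      expand : ∀ y z b → suc (y + z) * b ≡ y * b + z * b + b
      expand = solve-∀
      collect : ∀ n k a z b → n + suc k * a + z * b + b ≡ n + a + b + (k * a + z * b)
      collect = solve-∀
    mirror⇒gap : S m → ¬ S n
    mirror⇒gap (x₂ , y₂ , m≡) (x₁ , y₁ , n≡) = ab-not-sum (x₁ + x₂) (y₁ + y₂) (begin
      suc (x₁ + x₂) * a + suc (y₁ + y₂) * b            ≡⟨ regroup x₁ x₂ y₁ y₂ a b ⟩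
      (x₁ * a + y₁ * b) + (x₂ * a + y₂ * b) + a + b    ≡⟨ cong₂ (λ u v → u + v + a + b) (sym n≡) (sym m≡) ⟩
      n + m + a + b                                    ≡⟨ mirror-sum n<c ⟩
      a * b                                            ∎)
      where
      open ≡-Reasoning
      regroup : ∀ x₁ x₂ y₁ y₂ a b →
                suc (x₁ + x₂) * a + suc (y₁ + y₂) * b ≡ (x₁ * a + y₁ * b) + (x₂ * a + y₂ * b) + a + b
      regroup = solve-∀

  g : ℕ
  g = count (¬? ∘ S?) 0 c

  g+g≡c : g + g ≡ c
  g+g≡c = begin
    g + g                ≡⟨ cong (_+ g) gaps≡elements ⟩
    count S? 0 c + g     ≡⟨ count-complement S? 0 c ⟩
    c                    ∎
    where
    open ≡-Reasoning
    gaps≡elements : g ≡ count S? 0 c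
    gaps≡elements =
      trans (∑-cong c (λ {i} i∈ → 𝟙-cong (¬? (S? i)) (S? (c ∸ suc i)) (gap⇔mirror-element (proj₂ i∈))))
            (∑-reverse (𝟙 ∘ S?) c)

  μ : ℕ
  μ = count S? 1 g

  μ-is-ordinarization-number : IsOrdinarizationNumber S μ
  μ-is-ordinarization-number = ordinarization-number S? c (0 , 0 , refl) conductor

  module Estimates (1≤a₁ : 1 ≤ a₁) (a₁<b₁ : a₁ < b₁)
                   (K : ℕ) (K+K≤a : K + K ≤ a) (a≤1+K+K : a ≤ suc (K + K)) where

    a₁b≡a₁+g+g : a₁ * b ≡ a₁ + (g + g)
    a₁b≡a₁+g+g = trans (*-suc a₁ b₁) (cong (a₁ +_) (sym g+g≡c))

    yb≤g : ∀ {y} → y < K → y * b ≤ g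
    yb≤g {y} y<K = *-cancelˡ-≤ 2 (+-cancelʳ-≤ b _ _ (begin
      2 * (y * b) + b     ≡⟨ regroup y b ⟩
      suc (y + y) * b     ≤⟨ *-monoˡ-≤ b 1+y+y≤a₁ ⟩
      a₁ * b              ≡⟨ a₁b≡a₁+g+g ⟩
      a₁ + (g + g)        ≤⟨ +-monoˡ-≤ (g + g) (<⇒≤ (<-trans a₁<b₁ (n<1+n b₁))) ⟩
      b + (g + g)         ≡⟨ regroup′ b g ⟩
      2 * g + b           ∎))
      where
      open ≤-Reasoning
      regroup : ∀ y b → 2 * (y * b) + b ≡ suc (y + y) * b
      regroup = solve-∀
      regroup′ : ∀ b g → b + (g + g) ≡ 2 * g + b
      regroup′ = solve-∀
      1+y+y≤a₁ : suc (y + y) ≤ a₁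
      1+y+y≤a₁ = ≤-pred (≤-trans (subst (_≤ K + K) (cong suc (+-suc y y)) (+-mono-≤ y<K y<K)) K+K≤a)

    g<yb : ∀ {y} → K ≤ y → g < y * b
    g<yb {y} K≤y = ≰⇒> λ yb≤g → <⇒≱ g+g<yb+yb (+-mono-≤ yb≤g yb≤g)
      where
      open ≤-Reasoning
      g+g<yb+yb : g + g < y * b + y * b
      g+g<yb+yb = begin-strict
        g + g            <⟨ m<n+m (g + g) 1≤a₁ ⟩
        a₁ + (g + g)     ≡⟨ sym a₁b≡a₁+g+g ⟩
        a₁ * b           ≤⟨ *-monoˡ-≤ b (≤-trans (≤-pred a≤1+K+K) (+-mono-≤ K≤y K≤y)) ⟩
        (y + y) * b      ≡⟨ *-distribʳ-+ b y y ⟩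
        y * b + y * b    ∎

    K≤a : K ≤ a
    K≤a = ≤-trans (m≤m+n K K) K+K≤a

    h : ℕ → ℕ
    h y = count (Rep? y) 0 (suc g)

    ρ : ℕ → ℕ
    ρ y = (g ∸ y * b) % a

    representation-count : ∀ n → count (λ y → Rep? y n) 0 a ≡ 𝟙 (S? n)
    representation-count n with S? n
    ... | no ¬Sn = count-none (λ y → Rep? y n) a (λ {y} _ rep → ¬Sn (Rep⇒S {y} rep))
    ... | yes Sn with S⇒Rep Sn
    ...   | y , y<a , rep = count-unique (λ y → Rep? y n) a
            (λ i∈ j∈ repᵢ repⱼ → rep-unique (proj₂ i∈) (proj₂ j∈) repᵢ repⱼ) (z≤n , y<a) rep

    elements≡∑h : suc μ ≡ ∑ h 0 K
    elements≡∑h = begin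
      suc μ                                        ≡⟨ cong (_+ μ) (sym (𝟙-yes (S? 0) (0 , 0 , refl))) ⟩
      count S? 0 (suc g)                           ≡⟨ ∑-cong (suc g) (λ {n} _ → sym (representation-count n)) ⟩
      ∑ (λ n → count (λ y → Rep? y n) 0 a) 0 (suc g) ≡⟨ ∑-comm (λ n y → 𝟙 (Rep? y n)) 0 (suc g) 0 a ⟩
      ∑ h 0 a                                      ≡⟨ cong (∑ h 0) (sym (m+[n∸m]≡n K≤a)) ⟩
      ∑ h 0 (K + (a ∸ K))                          ≡⟨ ∑-split h 0 K (a ∸ K) ⟩
      ∑ h 0 K + ∑ h K (a ∸ K)                      ≡⟨ cong (∑ h 0 K +_) (trans (∑-cong (a ∸ K) (h-vanishes ∘ proj₁))
                                                                               (∑-zero K (a ∸ K))) ⟩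
      ∑ h 0 K + 0                                  ≡⟨ +-identityʳ _ ⟩
      ∑ h 0 K                                      ∎
      where
      open ≡-Reasoning
      h-vanishes : ∀ {y} → K ≤ y → h y ≡ 0
      h-vanishes {y} K≤y = count-none (Rep? y) (suc g) λ (_ , n<1+g) (x , n≡) →
        <⇒≱ (g<yb K≤y) (≤-trans (subst (y * b ≤_) (sym n≡) (m≤n+m (y * b) (x * a))) (≤-pred n<1+g))

    h≡suc-quotient : ∀ y → y * b ≤ g → h y ≡ suc ((g ∸ y * b) / a)
    h≡suc-quotient y yb≤g = begin
      count (Rep? y) 0 (suc g)                                   ≡⟨ cong (count (Rep? y) 0) 1+g≡ ⟩
      count (Rep? y) 0 (y * b + suc N)                           ≡⟨ ∑-split _ 0 (y * b) (suc N) ⟩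
      count (Rep? y) 0 (y * b) + count (Rep? y) (y * b) (suc N)  ≡⟨ cong (_+ count (Rep? y) (y * b) (suc N)) below-yb ⟩
      count (Rep? y) (y * b) (suc N)                             ≡⟨ cong (λ lo → count (Rep? y) lo (suc N))
                                                                         (sym (+-identityʳ (y * b))) ⟩
      count (Rep? y) (y * b + 0) (suc N)                         ≡⟨ ∑-shift (𝟙 ∘ Rep? y) (y * b) 0 (suc N) ⟩
      ∑ (λ j → 𝟙 (Rep? y (y * b + j))) 0 (suc N)                 ≡⟨ ∑-cong (suc N) (λ {j} _ → 𝟙-cong (Rep? y (y * b + j))
                                                                                                     (a ∣? j) shifted) ⟩
      count (a ∣?_) 0 (suc N)                                    ≡⟨ cong (count (a ∣?_) 0 ∘ suc) (m≡m%n+[m/n]*n N a) ⟩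
      count (a ∣?_) 0 (suc (N % a + N / a * a))                  ≡⟨ count-multiples a (N / a) (N % a) (m%n<n N a) ⟩
      suc (N / a)                                                ∎
      where
      open ≡-Reasoning
      N : ℕ
      N = g ∸ y * b
      1+g≡ : suc g ≡ y * b + suc N
      1+g≡ = sym (trans (+-suc (y * b) N) (cong suc (m+[n∸m]≡n yb≤g)))
      below-yb : count (Rep? y) 0 (y * b) ≡ 0
      below-yb = count-none (Rep? y) (y * b) λ (_ , n<yb) (x , n≡) →
        <⇒≱ n<yb (subst (y * b ≤_) (sym n≡) (m≤n+m (y * b) (x * a)))
      shifted : ∀ {j} → Rep y (y * b + j) ⇔ a ∣ j
      shifted {j} = mk⇔
        (λ (x , eq) → divides x (+-cancelˡ-≡ (y * b) j (x * a) (trans eq (+-comm (x * a) (y * b)))))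
        (λ (divides x j≡xa) → x , trans (cong (y * b +_) j≡xa) (+-comm (y * b) (x * a)))

    g-decomposition : ∀ y → y * b ≤ g → g ≡ ρ y + ((g ∸ y * b) / a * a + y * b)
    g-decomposition y yb≤g = begin
      g                                       ≡⟨ sym (m∸n+n≡m yb≤g) ⟩
      N + y * b                               ≡⟨ cong (_+ y * b) (m≡m%n+[m/n]*n N a) ⟩
      N % a + N / a * a + y * b               ≡⟨ +-assoc (N % a) _ _ ⟩
      N % a + (N / a * a + y * b)             ∎
      where
      open ≡-Reasoning
      N : ℕ
      N = g ∸ y * b

    h-formula : ∀ {y} → y < K → a * h y + ρ y + y * b ≡ g + a
    h-formula {y} y<K = begin
      a * h y + ρ y + y * b                       ≡⟨ cong (λ z → a * z + ρ y + y * b) (h≡suc-quotient y (yb≤g y<K)) ⟩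
      a * suc q + ρ y + y * b                     ≡⟨ regroup a q (ρ y) (y * b) ⟩
      ρ y + (q * a + y * b) + a                   ≡⟨ cong (_+ a) (sym (g-decomposition y (yb≤g y<K))) ⟩
      g + a                                       ∎
      where
      open ≡-Reasoning
      q : ℕ
      q = (g ∸ y * b) / a
      regroup : ∀ a q r t → a * suc q + r + t ≡ r + (q * a + t) + a
      regroup = solve-∀

    ρ-injective : ∀ {y₁ y₂} → y₁ < K → y₂ < K → ρ y₁ ≡ ρ y₂ → y₁ ≡ y₂
    ρ-injective {y₁} {y₂} y₁<K y₂<K ρ≡ =
      rep-unique (<-≤-trans y₁<K K≤a) (<-≤-trans y₂<K K≤a) (q₁ , refl) (q₂ , +-cancelˡ-≡ (ρ y₁) _ _ (begin
        ρ y₁ + (q₁ * a + y₁ * b)    ≡⟨ sym (g-decomposition y₁ (yb≤g y₁<K)) ⟩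
        g                           ≡⟨ g-decomposition y₂ (yb≤g y₂<K) ⟩
        ρ y₂ + (q₂ * a + y₂ * b)    ≡⟨ cong (_+ (q₂ * a + y₂ * b)) (sym ρ≡) ⟩
        ρ y₁ + (q₂ * a + y₂ * b)    ∎))
      where
      open ≡-Reasoning
      q₁ q₂ : ℕ
      q₁ = (g ∸ y₁ * b) / a
      q₂ = (g ∸ y₂ * b) / a

    counting-identity : a * suc μ + ∑ ρ 0 K + b * ∑ (λ y → y) 0 K ≡ K * (g + a)
    counting-identity = begin
      a * suc μ + ∑ ρ 0 K + b * ∑ (λ y → y) 0 K
        ≡⟨ cong₂ (λ u v → u + ∑ ρ 0 K + v) (trans (cong (a *_) elements≡∑h) (*-distribˡ-∑ a h 0 K))
                                           (*-distribˡ-∑ b (λ y → y) 0 K) ⟩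
      ∑ (λ y → a * h y) 0 K + ∑ ρ 0 K + ∑ (λ y → b * y) 0 K
        ≡⟨ cong (_+ ∑ (λ y → b * y) 0 K) (sym (∑-distrib-+ (λ y → a * h y) ρ 0 K)) ⟩
      ∑ (λ y → a * h y + ρ y) 0 K + ∑ (λ y → b * y) 0 K
        ≡⟨ sym (∑-distrib-+ (λ y → a * h y + ρ y) (λ y → b * y) 0 K) ⟩
      ∑ (λ y → a * h y + ρ y + b * y) 0 K
        ≡⟨ ∑-cong K (λ {y} y∈ → trans (cong (a * h y + ρ y +_) (*-comm b y)) (h-formula (proj₂ y∈))) ⟩
      ∑ (λ _ → g + a) 0 K
        ≡⟨ ∑-const (g + a) 0 K ⟩
      K * (g + a)                                 ∎
      where open ≡-Reasoning

    private
      R : ℕ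
      R = ∑ ρ 0 K

      residue-bounds : K * K ≤ 2 * R + K × 2 * R + K * suc K ≤ 2 * a * K
      residue-bounds = injective-sum-bounds ρ a K (λ {y} _ → m%n<n (g ∸ y * b) a) ρ-injective

      doubled-identity : 2 * R + (2 * a * suc μ + b * (K * K)) ≡ K * c + 2 * K * a + b * K
      doubled-identity = begin
        2 * R + (2 * a * suc μ + b * (K * K))          ≡⟨ cong (λ z → 2 * R + (2 * a * suc μ + b * z)) (sym (gauss-sum K)) ⟩
        2 * R + (2 * a * suc μ + b * (2 * T + K))      ≡⟨ regroup R a μ b T K ⟩
        2 * (a * suc μ + R + b * T) + b * K            ≡⟨ cong (λ z → 2 * z + b * K) counting-identity ⟩
        2 * (K * (g + a)) + b * K                      ≡⟨ regroup′ K g a b ⟩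
        K * (g + g) + 2 * K * a + b * K                ≡⟨ cong (λ z → K * z + 2 * K * a + b * K) g+g≡c ⟩
        K * c + 2 * K * a + b * K                      ∎
        where
        open ≡-Reasoning
        T : ℕ
        T = ∑ (λ y → y) 0 K
        regroup : ∀ R a μ b T K → 2 * R + (2 * a * suc μ + b * (2 * T + K)) ≡ 2 * (a * suc μ + R + b * T) + b * K
        regroup = solve-∀
        regroup′ : ∀ K g a b → 2 * (K * (g + a)) + b * K ≡ K * (g + g) + 2 * K * a + b * K
        regroup′ = solve-∀

    lower-estimate : K * c + 2 * K * a + b * K + K * suc K ≤ 2 * a * suc μ + b * (K * K) + 2 * a * K
    lower-estimate = begin
      K * c + 2 * K * a + b * K + K * suc K          ≡⟨ cong (_+ K * suc K) (sym doubled-identity) ⟩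
      2 * R + X + K * suc K                          ≡⟨ regroup R X (K * suc K) ⟩
      X + (2 * R + K * suc K)                        ≤⟨ +-monoʳ-≤ X (proj₂ residue-bounds) ⟩
      X + 2 * a * K                                  ∎
      where
      open ≤-Reasoning
      X : ℕ
      X = 2 * a * suc μ + b * (K * K)
      regroup : ∀ r x k → 2 * r + x + k ≡ x + (2 * r + k)
      regroup = solve-∀

    upper-estimate : 2 * a * suc μ + b * (K * K) + K * K ≤ K * c + 2 * K * a + b * K + K
    upper-estimate = begin
      X + K * K                                      ≤⟨ +-monoʳ-≤ X (proj₁ residue-bounds) ⟩
      X + (2 * R + K)                                ≡⟨ regroup R X K ⟩
      2 * R + X + K                                  ≡⟨ cong (_+ K) doubled-identity ⟩
      K * c + 2 * K * a + b * K + K                  ∎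
      where
      open ≤-Reasoning
      X : ℕ
      X = 2 * a * suc μ + b * (K * K)
      regroup : ∀ r x k → x + (2 * r + k) ≡ 2 * r + x + k
      regroup = solve-∀

-- Arithmetic consequences of the estimates

offset-≤ : ∀ {x y z w} → x + w ≡ y + z → z ≤ w → x ≤ y
offset-≤ {x} {y} {z} {w} eq z≤w = +-cancelʳ-≤ w x y (begin
  x + w   ≡⟨ eq ⟩
  y + z   ≤⟨ +-monoʳ-≤ y z≤w ⟩
  y + w   ∎)
  where open ≤-Reasoning

odd-bounds : ∀ K b₁ μ → let a = suc (K + K) ; b = suc b₁ in
  K * ((K + K) * b₁) + 2 * K * a + b * K + K * suc K ≤ 2 * a * suc μ + b * (K * K) + 2 * a * K →
  2 * a * suc μ + b * (K * K) + K * K ≤ K * ((K + K) * b₁) + 2 * K * a + b * K + K →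
  a * a * b ≤ 8 * a * μ + a * a + 4 * a + b + 3 × 8 * a * μ + 4 * a + b + 5 ≤ a * a * b + a * a
odd-bounds K b₁ μ lower upper = offset-≤ (lower-identity K b₁ μ) (*-monoʳ-≤ 4 lower) ,
                                offset-≤ (upper-identity K b₁ μ) (*-monoʳ-≤ 4 upper)
  where
  lower-identity : ∀ K b₁ μ → let a = suc (K + K) ; b = suc b₁ in
    a * a * b + 4 * (2 * a * suc μ + b * (K * K) + 2 * a * K) ≡
    8 * a * μ + a * a + 4 * a + b + 3 + 4 * (K * ((K + K) * b₁) + 2 * K * a + b * K + K * suc K)
  lower-identity = solve-∀
  upper-identity : ∀ K b₁ μ → let a = suc (K + K) ; b = suc b₁ in
    8 * a * μ + 4 * a + b + 5 + 4 * (K * ((K + K) * b₁) + 2 * K * a + b * K + K) ≡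
    a * a * b + a * a + 4 * (2 * a * suc μ + b * (K * K) + K * K)
  upper-identity = solve-∀

even-bounds : ∀ K b₁ μ → let k = suc K ; a = k + k ; b = suc b₁ in
  k * ((K + k) * b₁) + 2 * k * a + b * k + k * suc k ≤ 2 * a * suc μ + b * (k * k) + 2 * a * k →
  2 * a * suc μ + b * (k * k) + k * k ≤ k * ((K + k) * b₁) + 2 * k * a + b * k + k →
  a * b ≤ 8 * μ + a + 4 × 8 * μ + 4 ≤ a * b + a
even-bounds K b₁ μ lower upper = *-cancelˡ-≤ (suc K) (offset-≤ (lower-identity K b₁ μ) (*-monoʳ-≤ 2 lower)) ,
                                 *-cancelˡ-≤ (suc K) (offset-≤ (upper-identity K b₁ μ) (*-monoʳ-≤ 2 upper))
  where
  lower-identity : ∀ K b₁ μ → let k = suc K ; a = k + k ; b = suc b₁ in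
    k * (a * b) + 2 * (2 * a * suc μ + b * (k * k) + 2 * a * k) ≡
    k * (8 * μ + a + 4) + 2 * (k * ((K + k) * b₁) + 2 * k * a + b * k + k * suc k)
  lower-identity = solve-∀
  upper-identity : ∀ K b₁ μ → let k = suc K ; a = k + k ; b = suc b₁ in
    k * (8 * μ + 4) + 2 * (k * ((K + k) * b₁) + 2 * k * a + b * k + k) ≡
    k * (a * b + a) + 2 * (2 * a * suc μ + b * (k * k) + k * k)
  upper-identity = solve-∀

parity : ∀ n → ∃[ K ] (n ≡ K + K ⊎ n ≡ K + suc K)
parity zero = 0 , inj₁ refl
parity (suc n) with parity n
... | K , inj₁ n≡K+K   = K , inj₂ (trans (cong suc n≡K+K) (sym (+-suc K K)))
... | K , inj₂ n≡K+1+K = suc K , inj₁ (cong suc n≡K+1+K)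

2∣K+K : ∀ K → 2 ∣ K + K
2∣K+K K = divides K (trans (cong (K +_) (sym (+-identityʳ K))) (*-comm 2 K))

¬2∣1+K+K : ∀ K → ¬ 2 ∣ suc (K + K)
¬2∣1+K+K K 2∣ = contradiction (∣1⇒≡1 (∣m+n∣m⇒∣n (subst (2 ∣_) (+-comm 1 (K + K)) 2∣) (2∣K+K K))) λ ()

-- The rational bounds of the statement

open import Data.Integer using (+_)
import Data.Integer as ℤ
import Data.Integer.Properties as ℤₚ
open import Data.Integer.Tactic.RingSolver using () renaming (solve-∀ to solveℤ-∀)
open import Data.Rational using (toℚᵘ)
import Data.Rational as ℚ
import Data.Rational.Properties as ℚₚ
open import Data.Rational.Unnormalised using (ℚᵘ; mkℚᵘ; *≤*) renaming (_≃_ to _≃ᵘ_; _≤_ to _≤ᵘ_; _-_ to _-ᵘ_)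
import Data.Rational.Unnormalised.Properties as ℚᵘₚ

centre : ℕ → ℕ → ℚ
centre a b = (+ (a * b) ℤ.- + a ℤ.- + 4) /ₙ 8

OddBounds : ℕ → ℕ → ℕ → Set
OddBounds a b r = 0ℚ ≤ℚ δ × δ ≤ℚ (((+ a) /ₙ 4) -ℚ ((+ 1) /ₙ (4 * a)))
  where
  δ : ℚ
  δ = ((+ r) /ₙ 1) -ℚ (centre a b -ℚ ((+ b ℤ.+ + 3) /ₙ (8 * a)))

EvenBounds : ℕ → ℕ → ℕ → Set
EvenBounds a b r = 0ℚ ≤ℚ δ × δ ≤ℚ ((+ a) /ₙ 4)
  where
  δ : ℚ
  δ = ((+ r) /ₙ 1) -ℚ centre a b

toℚᵘ-/ₙ : ∀ n d → toℚᵘ (n /ₙ suc d) ≃ᵘ mkℚᵘ n d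
toℚᵘ-/ₙ n d = ℚₚ.toℚᵘ-fromℚᵘ (mkℚᵘ n d)

toℚᵘ-homo-difference : ∀ {p q u v} → toℚᵘ p ≃ᵘ u → toℚᵘ q ≃ᵘ v → toℚᵘ (p -ℚ q) ≃ᵘ u -ᵘ v
toℚᵘ-homo-difference {p} {q} p≃u q≃v = ℚᵘₚ.≃-trans (ℚₚ.toℚᵘ-homo-+ p (ℚ.- q))
  (ℚᵘₚ.+-cong p≃u (ℚᵘₚ.≃-trans (ℚₚ.toℚᵘ-homo‿- q) (ℚᵘₚ.-‿cong q≃v)))

≤-fromℚᵘ : ∀ {p q u v} → toℚᵘ p ≃ᵘ u → toℚᵘ q ≃ᵘ v → u ≤ᵘ v → p ≤ℚ q
≤-fromℚᵘ p≃u q≃v u≤v =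
  ℚₚ.toℚᵘ-cancel-≤ (ℚᵘₚ.≤-respˡ-≃ (ℚᵘₚ.≃-sym p≃u) (ℚᵘₚ.≤-respʳ-≃ (ℚᵘₚ.≃-sym q≃v) u≤v))

≤-by-scaling : ∀ {x y z w : ℤ.ℤ} k → y ℤ.- x ≡ + k ℤ.* (w ℤ.- z) → z ℤ.≤ w → x ℤ.≤ y
≤-by-scaling {z = z} {w} k eq z≤w = ℤₚ.0≤i-j⇒j≤i (subst (ℤ.0ℤ ℤ.≤_) (sym eq)
  (subst (ℤ._≤ + k ℤ.* (w ℤ.- z)) (ℤₚ.*-zeroʳ (+ k)) (ℤₚ.*-monoˡ-≤-nonNeg (+ k) (ℤₚ.i≤j⇒0≤j-i z≤w))))

odd-bounds-ℚ : ∀ a₁ b₁ r → let a = suc a₁ ; b = suc b₁ in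
  a * a * b ≤ 8 * a * r + a * a + 4 * a + b + 3 →
  8 * a * r + 4 * a + b + 5 ≤ a * a * b + a * a →
  OddBounds a b r
odd-bounds-ℚ a₁ b₁ r lower upper =
  ≤-fromℚᵘ ℚᵘₚ.≃-refl δ≃ (*≤* (≤-by-scaling 8 (lower-cross-multiplied A B R) lowerℤ)) ,
  ≤-fromℚᵘ δ≃ (toℚᵘ-homo-difference (toℚᵘ-/ₙ A 3) (toℚᵘ-/ₙ (+ 1) (pred (4 * a))))
    (*≤* (≤-by-scaling (128 * a) (upper-cross-multiplied A B R) upperℤ))
  where
  a b : ℕ
  a = suc a₁
  b = suc b₁
  A B R : ℤ.ℤ
  A = + a
  B = + b
  R = + r
  δ≃ : toℚᵘ (((+ r) /ₙ 1) -ℚ (centre a b -ℚ ((+ b ℤ.+ + 3) /ₙ (8 * a))))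
       ≃ᵘ mkℚᵘ R 0 -ᵘ (mkℚᵘ (A ℤ.* B ℤ.- A ℤ.- + 4) 7 -ᵘ mkℚᵘ (B ℤ.+ + 3) (pred (8 * a)))
  δ≃ = toℚᵘ-homo-difference (toℚᵘ-/ₙ R 0)
         (toℚᵘ-homo-difference (toℚᵘ-/ₙ (A ℤ.* B ℤ.- A ℤ.- + 4) 7) (toℚᵘ-/ₙ (B ℤ.+ + 3) (pred (8 * a))))
  lowerℤ : A ℤ.* A ℤ.* B ℤ.≤ + 8 ℤ.* A ℤ.* R ℤ.+ A ℤ.* A ℤ.+ + 4 ℤ.* A ℤ.+ B ℤ.+ + 3
  lowerℤ = subst (λ z → A ℤ.* A ℤ.* B ℤ.≤ z ℤ.+ A ℤ.* A ℤ.+ + 4 ℤ.* A ℤ.+ B ℤ.+ + 3)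
                 (ℤₚ.pos-* (8 * a) r) (ℤ.+≤+ lower)
  upperℤ : + 8 ℤ.* A ℤ.* R ℤ.+ + 4 ℤ.* A ℤ.+ B ℤ.+ + 5 ℤ.≤ A ℤ.* A ℤ.* B ℤ.+ A ℤ.* A
  upperℤ = subst (λ z → z ℤ.+ + 4 ℤ.* A ℤ.+ B ℤ.+ + 5 ℤ.≤ A ℤ.* A ℤ.* B ℤ.+ A ℤ.* A)
                 (ℤₚ.pos-* (8 * a) r) (ℤ.+≤+ upper)
  -- a and b are successors, so the left-hand sides are definitionally the cross-multiplied
  -- numerators and denominators that ℚᵘ computes for the two inequalities
  lower-cross-multiplied : ∀ A B R →
    (R ℤ.* (+ 8 ℤ.* (+ 8 ℤ.* A)) ℤ.+ ℤ.- ((A ℤ.* B ℤ.- A ℤ.- + 4) ℤ.* (+ 8 ℤ.* A) ℤ.+ ℤ.- (B ℤ.+ + 3) ℤ.* + 8) ℤ.* + 1) ℤ.* + 1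
      ℤ.- + 0 ℤ.* (+ 1 ℤ.* (+ 8 ℤ.* (+ 8 ℤ.* A)))
    ≡ + 8 ℤ.* ((+ 8 ℤ.* A ℤ.* R ℤ.+ A ℤ.* A ℤ.+ + 4 ℤ.* A ℤ.+ B ℤ.+ + 3) ℤ.- A ℤ.* A ℤ.* B)
  lower-cross-multiplied = solveℤ-∀
  upper-cross-multiplied : ∀ A B R →
    (A ℤ.* (+ 4 ℤ.* A) ℤ.+ ℤ.- (+ 1) ℤ.* + 4) ℤ.* (+ 1 ℤ.* (+ 8 ℤ.* (+ 8 ℤ.* A)))
      ℤ.- (R ℤ.* (+ 8 ℤ.* (+ 8 ℤ.* A)) ℤ.+ ℤ.- ((A ℤ.* B ℤ.- A ℤ.- + 4) ℤ.* (+ 8 ℤ.* A) ℤ.+ ℤ.- (B ℤ.+ + 3) ℤ.* + 8) ℤ.* + 1)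
          ℤ.* (+ 4 ℤ.* (+ 4 ℤ.* A))
    ≡ + 128 ℤ.* A ℤ.* ((A ℤ.* A ℤ.* B ℤ.+ A ℤ.* A) ℤ.- (+ 8 ℤ.* A ℤ.* R ℤ.+ + 4 ℤ.* A ℤ.+ B ℤ.+ + 5))
  upper-cross-multiplied = solveℤ-∀

even-bounds-ℚ : ∀ a₁ b₁ r → let a = suc a₁ ; b = suc b₁ in
  a * b ≤ 8 * r + a + 4 → 8 * r + 4 ≤ a * b + a → EvenBounds a b r
even-bounds-ℚ a₁ b₁ r lower upper =
  ≤-fromℚᵘ ℚᵘₚ.≃-refl δ≃ (*≤* (≤-by-scaling 1 (lower-cross-multiplied A B R) lowerℤ)) ,
  ≤-fromℚᵘ δ≃ (toℚᵘ-/ₙ A 3) (*≤* (≤-by-scaling 4 (upper-cross-multiplied A B R) upperℤ))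
  where
  a b : ℕ
  a = suc a₁
  b = suc b₁
  A B R : ℤ.ℤ
  A = + a
  B = + b
  R = + r
  δ≃ : toℚᵘ (((+ r) /ₙ 1) -ℚ centre a b) ≃ᵘ mkℚᵘ R 0 -ᵘ mkℚᵘ (A ℤ.* B ℤ.- A ℤ.- + 4) 7
  δ≃ = toℚᵘ-homo-difference (toℚᵘ-/ₙ R 0) (toℚᵘ-/ₙ (A ℤ.* B ℤ.- A ℤ.- + 4) 7)
  lowerℤ : A ℤ.* B ℤ.≤ + 8 ℤ.* R ℤ.+ A ℤ.+ + 4
  lowerℤ = subst (λ z → A ℤ.* B ℤ.≤ z ℤ.+ A ℤ.+ + 4) (ℤₚ.pos-* 8 r) (ℤ.+≤+ lower)
  upperℤ : + 8 ℤ.* R ℤ.+ + 4 ℤ.≤ A ℤ.* B ℤ.+ A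
  upperℤ = subst (λ z → z ℤ.+ + 4 ℤ.≤ A ℤ.* B ℤ.+ A) (ℤₚ.pos-* 8 r) (ℤ.+≤+ upper)
  lower-cross-multiplied : ∀ A B R →
    (R ℤ.* + 8 ℤ.+ ℤ.- (A ℤ.* B ℤ.- A ℤ.- + 4) ℤ.* + 1) ℤ.* + 1 ℤ.- + 0 ℤ.* (+ 1 ℤ.* + 8)
    ≡ + 1 ℤ.* ((+ 8 ℤ.* R ℤ.+ A ℤ.+ + 4) ℤ.- A ℤ.* B)
  lower-cross-multiplied = solveℤ-∀
  upper-cross-multiplied : ∀ A B R →
    A ℤ.* (+ 1 ℤ.* + 8) ℤ.- (R ℤ.* + 8 ℤ.+ ℤ.- (A ℤ.* B ℤ.- A ℤ.- + 4) ℤ.* + 1) ℤ.* + 4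
    ≡ + 4 ℤ.* ((A ℤ.* B ℤ.+ A) ℤ.- (+ 8 ℤ.* R ℤ.+ + 4))
  upper-cross-multiplied = solveℤ-∀

mainTheorem4 : (a b : ℕ) → 2 ≤ a → a < b → gcd a b ≡ 1 →
    ∃[ r ] (IsOrdinarizationNumber ⟨ a , b ⟩ r ×
      ((¬ (2 ∣ a) →
          (0ℚ ≤ℚ (((+ r) /ₙ 1) -ℚ (((+ (a * b) Data.Integer.- + a Data.Integer.- + 4) /ₙ 8) -ℚ ((+ b Data.Integer.+ + 3) /ₙ (8 * a)))))
        × ((((+ r) /ₙ 1) -ℚ (((+ (a * b) Data.Integer.- + a Data.Integer.- + 4) /ₙ 8) -ℚ ((+ b Data.Integer.+ + 3) /ₙ (8 * a)))) ≤ℚ (((+ a) /ₙ 4) -ℚ ((+ 1) /ₙ (4 * a)))))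
       × (2 ∣ a →
          (0ℚ ≤ℚ (((+ r) /ₙ 1) -ℚ ((+ (a * b) Data.Integer.- + a Data.Integer.- + 4) /ₙ 8)))
        × ((((+ r) /ₙ 1) -ℚ ((+ (a * b) Data.Integer.- + a Data.Integer.- + 4) /ₙ 8)) ≤ℚ ((+ a) /ₙ 4)))))
mainTheorem4 (suc a₁) (suc b₁) (s≤s 1≤a₁) (s≤s a₁<b₁) gcd≡1 with parity a₁
... | K , inj₁ refl =
  μ , μ-is-ordinarization-number ,
  (λ _ → uncurry (odd-bounds-ℚ (K + K) b₁ μ) (odd-bounds K b₁ μ lower-estimate upper-estimate)) ,
  (λ 2∣a → contradiction 2∣a (¬2∣1+K+K K))
  where
  open TwoGenerated (K + K) b₁ (gcd≡1⇒coprime gcd≡1)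
  open Estimates 1≤a₁ a₁<b₁ K (n≤1+n (K + K)) ≤-refl
... | K , inj₂ refl =
  μ , μ-is-ordinarization-number ,
  (λ ¬2∣a → contradiction (2∣K+K (suc K)) ¬2∣a) ,
  (λ _ → uncurry (even-bounds-ℚ (K + suc K) b₁ μ) (even-bounds K b₁ μ lower-estimate upper-estimate))
  where
  open TwoGenerated (K + suc K) b₁ (gcd≡1⇒coprime gcd≡1)
  open Estimates 1≤a₁ a₁<b₁ (suc K) ≤-refl (n≤1+n (suc K + suc K))
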